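{- Let $D=(d_1,\ldots,d_n)$ be a forcibly bicyclic graphic sequence. If $D$ has a realization $G$ containing a generalized bowtie graph $B(r,s)$ as a subgraph, then there exists another realization $G'$ of $D$ containing a generalized bowtie graph $B(3,r+s-3)$ as a subgraph.
   Context: All graphs are simple. A realization of a sequence $D=(d_1,\ldots,d_n)$ is a simple graph with vertices $v_1,\ldots,v_n$ with $\deg(v_i)=d_i$; $D$ is graphic if it has a realization. A graphic sequence is forcibly bicyclic if every realization of it is connected and has exactly $n+1$ edges. $C_k$ denotes the cycle on $k$ vertices. The generalized bowtie $B(r,s)$ is obtained from disjoint copies of $C_r$ and $C_s$ by identifying a vertex of $C_r$ with a vertex of $C_s$. -}

module Defs where

open import Data.Nat using (ℕ; zero; suc; _+_; _∸_; _<ᵇ_)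
open import Data.Bool using (Bool; true; false; if_then_else_; _∧_)
open import Data.Fin using (Fin; toℕ) renaming (zero to fzero; suc to fsuc)
open import Data.List using (List; map; allFin)
open import Data.Nat.ListAction using (sum)
open import Data.Product using (Σ; _×_; ∃; ∃-syntax)
open import Relation.Binary.PropositionalEquality using (_≡_)
open import Function.Definitions using (Injective)

-- A simple graph on the vertex set Fin n (vertex i stands for v_{i+1}):
-- a symmetric, irreflexive adjacency relation.
record Graph (n : ℕ) : Set where
  field
    adj     : Fin n → Fin n → Bool
    sym     : ∀ i j → adj i j ≡ adj j i
    irrefl  : ∀ i → adj i i ≡ false
open Graph public

degree : ∀ {n} → Graph n → Fin n → ℕ
degree {n} G i = sum (map (λ j → if adj G i j then 1 else 0) (allFin n))

edgeCount : ∀ {n} → Graph n → ℕ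
edgeCount {n} G =
  sum (map (λ i → sum (map (λ j → if adj G i j ∧ (toℕ i <ᵇ toℕ j) then 1 else 0)
                           (allFin n)))
           (allFin n))

Realizes : ∀ {n} → Graph n → (Fin n → ℕ) → Set
Realizes {n} G D = ∀ (i : Fin n) → degree G i ≡ D i

Graphic : ∀ {n} → (Fin n → ℕ) → Set
Graphic {n} D = Σ (Graph n) λ G → Realizes G D

data Walk {n} (G : Graph n) : Fin n → Fin n → Set where
  here : ∀ {u} → Walk G u u
  step : ∀ {u w v} → adj G u w ≡ true → Walk G w v → Walk G u v

Connected : ∀ {n} → Graph n → Set
Connected {n} G = ∀ (u v : Fin n) → Walk G u v

ForciblyBicyclic : ∀ {n} → (Fin n → ℕ) → Set
ForciblyBicyclic {n} D =
  Graphic D × (∀ (G : Graph n) → Realizes G D → Connected G × edgeCount G ≡ n + 1)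

nextMod : ∀ {m} → Fin (suc m) → Fin (suc m)
nextMod {zero} i = fzero
nextMod {suc m} fzero = fsuc fzero
nextMod {suc m} (fsuc i) with nextMod {m} i
... | fzero = fzero
... | fsuc j = fsuc (fsuc j)

IsCycle : ∀ {n} (G : Graph n) (m : ℕ) → (Fin (suc m) → Fin n) → Set
IsCycle G m c = Injective _≡_ _≡_ c × (∀ i → adj G (c i) (c (nextMod i)) ≡ true)

ContainsBowtie : ∀ {n} → Graph n → ℕ → ℕ → Set
ContainsBowtie {n} G r s =
  Σ (Fin (suc (r ∸ 1)) → Fin n) λ c₁ →
  Σ (Fin (suc (s ∸ 1)) → Fin n) λ c₂ →
    IsCycle G (r ∸ 1) c₁ × IsCycle G (s ∸ 1) c₂ × c₁ fzero ≡ c₂ fzero ×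
    (∀ i j → c₁ i ≡ c₂ j → (i ≡ fzero × j ≡ fzero))

-- Write the bowtie as cycles A = x … p q L and B = x b … with common vertex x; if r = 3 there is
-- nothing to do. A connected graph with n + 1 edges cannot lose three edges one after another, each
-- lying on a cycle of what remains, because a connected graph on n vertices has at least n − 1 edges.
-- Hence neither xq nor pb is an edge: otherwise that edge, the closing edge of A and the closing edge
-- of B could be deleted in turn. So the 2-switch replacing xb and pq by xq and pb preserves all
-- degrees, and it creates the triangle x q L and the cycle x … p b … of length r + s − 3, which
-- meet only in x.

module Submission where

open import Defs hiding (sym)
open import Data.Bool using (Bool; true; false; if_then_else_; _∧_; _∨_; not)
open import Data.Bool.Properties
  using (T-≡; ¬-not; ∨-zeroʳ; ∨-identityʳ; ∧-identityʳ; ∧-zeroʳ; ∧-comm; ∨-comm) renaming (_≟_ to _≟ᵇ_)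
open import Data.Empty using (⊥; ⊥-elim)
open import Data.Fin using (Fin; toℕ) renaming (zero to fzero; suc to fsuc)
open import Data.Fin.Properties using (_≟_; any?; toℕ-injective; toℕ≤pred[n])
open import Data.List using (map; tabulate)
import Data.Nat.ListAction as List
open import Data.Nat using (ℕ; zero; suc; _+_; _∸_; _≤_; _<_; _<ᵇ_; z≤n; s≤s)
open import Data.Nat.Properties hiding (_≟_)
open import Algebra.Properties.CommutativeMonoid.Sum +-0-commutativeMonoid
  using (sum; sum-syntax; sum-cong-≗; sum-replicate-zero; ∑-distrib-+; ∑-comm)
open import Data.Product using (Σ; Σ-syntax; _×_; _,_; proj₁; proj₂)
open import Data.Sum using (_⊎_; inj₁; inj₂)
open import Function using (_∘_; id; case_of_)
open import Function.Bundles using (Equivalence)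
open import Relation.Binary using (tri<; tri≈; tri>)
open import Relation.Binary.PropositionalEquality
  using (_≡_; _≢_; refl; sym; trans; cong; cong₂; subst; subst₂; ≢-sym; module ≡-Reasoning)
open import Relation.Nullary using (¬_; Dec; yes; no; does)
open import Relation.Nullary.Decidable using (dec-true; dec-false)

-- Counting

∧-true : ∀ {a b} → (a ∧ b) ≡ true → a ≡ true × b ≡ true
∧-true {true} {true} _ = refl , refl

∨-true : ∀ {a b} → (a ∨ b) ≡ true → a ≡ true ⊎ b ≡ true
∨-true {true} _ = inj₁ refl
∨-true {false} b≡true = inj₂ b≡true

<ᵇ-true : ∀ {m n} → m < n → (m <ᵇ n) ≡ true
<ᵇ-true m<n = Equivalence.to T-≡ (<⇒<ᵇ m<n)

<ᵇ-false : ∀ {m n} → n ≤ m → (m <ᵇ n) ≡ false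
<ᵇ-false {m} {n} n≤m with m <ᵇ n in eq
... | false = refl
... | true = ⊥-elim (≤⇒≯ n≤m (<ᵇ⇒< m n (Equivalence.from T-≡ eq)))

∨-falseˡ : ∀ {a b} → (a ∨ b) ≡ false → a ≡ false
∨-falseˡ {false} _ = refl

𝟙 : Bool → ℕ
𝟙 b = if b then 1 else 0

listSum-tabulate : ∀ {A : Set} {n} (f : A → ℕ) (g : Fin n → A) →
  List.sum (map f (tabulate g)) ≡ ∑[ i < n ] f (g i)
listSum-tabulate {n = zero} f g = refl
listSum-tabulate {n = suc n} f g = cong (f (g fzero) +_) (listSum-tabulate f (g ∘ fsuc))

∑-zero : ∀ {n} (f : Fin n → ℕ) → (∀ i → f i ≡ 0) → sum f ≡ 0
∑-zero {n} f f≗0 = trans (sum-cong-≗ f≗0) (sum-replicate-zero n)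

∑-mono-≤ : ∀ {n} {f g : Fin n → ℕ} → (∀ i → f i ≤ g i) → sum f ≤ sum g
∑-mono-≤ {zero} f≤g = z≤n
∑-mono-≤ {suc n} f≤g = +-mono-≤ (f≤g fzero) (∑-mono-≤ (f≤g ∘ fsuc))

∑-one : ∀ n → ∑[ i < n ] 1 ≡ n
∑-one zero = refl
∑-one (suc n) = cong suc (∑-one n)

_==_ : ∀ {n} → Fin n → Fin n → Bool
i == j = does (i ≟ j)

==-refl : ∀ {n} (i : Fin n) → (i == i) ≡ true
==-refl i = dec-true (i ≟ i) refl

does⇒ : ∀ {P : Set} (P? : Dec P) → does P? ≡ true → P
does⇒ (yes p) _ = p

==⇒≡ : ∀ {n} {i j : Fin n} → (i == j) ≡ true → i ≡ j
==⇒≡ {i = i} {j} = does⇒ (i ≟ j)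

not-==⇒≢ : ∀ {n} {i j : Fin n} → not (i == j) ≡ true → i ≢ j
not-==⇒≢ {i = i} e refl rewrite ==-refl i = case e of λ ()

∑-indicator : ∀ {n} (k : Fin n) → ∑[ j < n ] 𝟙 (j == k) ≡ 1
∑-indicator {suc n} fzero = cong suc (∑-zero {n} _ λ _ → refl)
∑-indicator {suc n} (fsuc k) = ∑-indicator k

∑-exchange : ∀ {N} (f : Fin N → Bool) {lose gain : Fin N} → lose ≢ gain → f lose ≡ true → f gain ≡ false →
  ∑[ j < N ] 𝟙 ((f j ∧ not (j == lose)) ∨ (j == gain)) ≡ ∑[ j < N ] 𝟙 (f j)
∑-exchange {N} f {lose} {gain} lose≢gain f-lose f-gain = +-cancelʳ-≡ 1 _ _ (begin
  ∑[ j < N ] 𝟙 ((f j ∧ not (j == lose)) ∨ (j == gain)) + 1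
    ≡⟨ cong (∑[ j < N ] 𝟙 ((f j ∧ not (j == lose)) ∨ (j == gain)) +_) (sym (∑-indicator lose)) ⟩
  ∑[ j < N ] 𝟙 ((f j ∧ not (j == lose)) ∨ (j == gain)) + ∑[ j < N ] 𝟙 (j == lose)
    ≡⟨ sym (∑-distrib-+ {N} _ _) ⟩
  ∑[ j < N ] (𝟙 ((f j ∧ not (j == lose)) ∨ (j == gain)) + 𝟙 (j == lose))
    ≡⟨ sum-cong-≗ pointwise ⟩
  ∑[ j < N ] (𝟙 (f j) + 𝟙 (j == gain))
    ≡⟨ ∑-distrib-+ {N} _ _ ⟩
  ∑[ j < N ] 𝟙 (f j) + ∑[ j < N ] 𝟙 (j == gain)
    ≡⟨ cong (∑[ j < N ] 𝟙 (f j) +_) (∑-indicator gain) ⟩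
  ∑[ j < N ] 𝟙 (f j) + 1 ∎)
  where
  open ≡-Reasoning
  pointwise : ∀ j → 𝟙 ((f j ∧ not (j == lose)) ∨ (j == gain)) + 𝟙 (j == lose) ≡ 𝟙 (f j) + 𝟙 (j == gain)
  pointwise j with j ≟ lose | j ≟ gain
  ... | yes refl | yes refl = ⊥-elim (lose≢gain refl)
  ... | yes refl | no _ rewrite f-lose | ∧-zeroʳ true = refl
  ... | no _ | yes refl rewrite f-gain = refl
  ... | no _ | no _ rewrite ∧-identityʳ (f j) | ∨-identityʳ (f j) = refl

-- Edge deletion and connectivity

sameEdge : ∀ {n} → Fin n → Fin n → Fin n → Fin n → Bool
sameEdge i j u v = (i == u ∧ j == v) ∨ (i == v ∧ j == u)

sameEdge-sound : ∀ {n} {i j u v : Fin n} → sameEdge i j u v ≡ true → (i ≡ u × j ≡ v) ⊎ (i ≡ v × j ≡ u)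
sameEdge-sound eq with ∨-true eq
... | inj₁ e = let (iu , jv) = ∧-true e in inj₁ (==⇒≡ iu , ==⇒≡ jv)
... | inj₂ e = let (iv , ju) = ∧-true e in inj₂ (==⇒≡ iv , ==⇒≡ ju)

sameEdge-false : ∀ {n} {i j u v : Fin n} → ¬ ((i ≡ u × j ≡ v) ⊎ (i ≡ v × j ≡ u)) → sameEdge i j u v ≡ false
sameEdge-false {i = i} {j} {u} {v} ne with sameEdge i j u v in eq
... | true = ⊥-elim (ne (sameEdge-sound eq))
... | false = refl

sameEdge-refl : ∀ {n} (u v : Fin n) → sameEdge u v u v ≡ true
sameEdge-refl u v rewrite ==-refl u | ==-refl v = refl

sameEdge-symˡ : ∀ {n} (i j u v : Fin n) → sameEdge i j u v ≡ sameEdge j i u v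
sameEdge-symˡ i j u v =
  trans (cong₂ _∨_ (∧-comm (i == u) _) (∧-comm (i == v) _)) (∨-comm (j == v ∧ i == u) _)

sameEdge-symʳ : ∀ {n} (i j u v : Fin n) → sameEdge i j u v ≡ sameEdge i j v u
sameEdge-symʳ i j u v = ∨-comm (i == u ∧ j == v) _

sameEdge-loop : ∀ {n} {u v : Fin n} (i : Fin n) → u ≢ v → sameEdge i i u v ≡ false
sameEdge-loop {u = u} {v} i u≢v = sameEdge-false {i = i} {i} {u} {v} λ
  { (inj₁ (refl , refl)) → u≢v refl
  ; (inj₂ (refl , refl)) → u≢v refl }

sameEdge-outside : ∀ {n} {i u v : Fin n} (j : Fin n) → i ≢ u → i ≢ v → sameEdge i j u v ≡ false
sameEdge-outside {i = i} {u} {v} j i≢u i≢v = sameEdge-false {i = i} {j} {u} {v} λ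
  { (inj₁ (i≡u , _)) → i≢u i≡u
  ; (inj₂ (i≡v , _)) → i≢v i≡v }

sameEdge-missing : ∀ {n} {i j u : Fin n} (v : Fin n) → i ≢ u → j ≢ u → sameEdge i j u v ≡ false
sameEdge-missing {i = i} {j} {u} v i≢u j≢u = sameEdge-false {i = i} {j} {u} {v} λ
  { (inj₁ (i≡u , _)) → i≢u i≡u
  ; (inj₂ (_ , j≡u)) → j≢u j≡u }

sameEdge-endpointˡ : ∀ {n} {i v : Fin n} (j : Fin n) → i ≢ v → sameEdge i j i v ≡ (j == v)
sameEdge-endpointˡ {i = i} {v} j i≢v rewrite ==-refl i | dec-false (i ≟ v) i≢v = ∨-identityʳ (j == v)

sameEdge-endpointʳ : ∀ {n} {i u : Fin n} (j : Fin n) → i ≢ u → sameEdge i j u i ≡ (j == u)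
sameEdge-endpointʳ {i = i} {u} j i≢u rewrite ==-refl i | dec-false (i ≟ u) i≢u = refl

deleteEdge : ∀ {n} → Graph n → Fin n → Fin n → Graph n
deleteEdge G u v = record
  { adj = λ i j → adj G i j ∧ not (sameEdge i j u v)
  ; sym = λ i j → cong₂ (λ a b → a ∧ not b) (Graph.sym G i j) (sameEdge-symˡ i j u v)
  ; irrefl = λ i → cong (_∧ _) (irrefl G i) }

deleteEdge-adj : ∀ {n} (G : Graph n) {u v i j : Fin n} →
  adj G i j ≡ true → sameEdge i j u v ≡ false → adj (deleteEdge G u v) i j ≡ true
deleteEdge-adj G e s rewrite e | s = refl

deleteEdge-swap : ∀ {n} (G : Graph n) (u v i j : Fin n) →
  adj (deleteEdge G u v) i j ≡ adj (deleteEdge G v u) i j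
deleteEdge-swap G u v i j = cong (λ b → adj G i j ∧ not b) (sameEdge-symʳ i j u v)

degree-∑ : ∀ {n} (G : Graph n) (i : Fin n) → degree G i ≡ ∑[ j < n ] 𝟙 (adj G i j)
degree-∑ {n} G i = listSum-tabulate {n = n} _ id

edgeEntry : ∀ {n} → Graph n → Fin n → Fin n → ℕ
edgeEntry G i j = 𝟙 (adj G i j ∧ (toℕ i <ᵇ toℕ j))

edgeCount-∑ : ∀ {n} (G : Graph n) → edgeCount G ≡ ∑[ i < n ] ∑[ j < n ] edgeEntry G i j
edgeCount-∑ {n} G =
  trans (listSum-tabulate {n = n} _ id) (sum-cong-≗ {n} λ i → listSum-tabulate {n = n} (λ j → edgeEntry G i j) id)

edgeCount-cong : ∀ {n} (G H : Graph n) → (∀ i j → adj G i j ≡ adj H i j) → edgeCount G ≡ edgeCount H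
edgeCount-cong G H G≗H = begin
  edgeCount G                                 ≡⟨ edgeCount-∑ G ⟩
  ∑[ i < _ ] ∑[ j < _ ] edgeEntry G i j      ≡⟨ sum-cong-≗ (λ i → sum-cong-≗ λ j → cong (λ b → 𝟙 (b ∧ _)) (G≗H i j)) ⟩
  ∑[ i < _ ] ∑[ j < _ ] edgeEntry H i j      ≡⟨ sym (edgeCount-∑ H) ⟩
  edgeCount H                                 ∎
  where open ≡-Reasoning

∑-indicator-pair : ∀ {n} (u v : Fin n) → ∑[ i < n ] ∑[ j < n ] 𝟙 (i == u ∧ j == v) ≡ 1
∑-indicator-pair {n} u v = trans (sum-cong-≗ row) (∑-indicator u)
  where
  row : ∀ i → ∑[ j < n ] 𝟙 (i == u ∧ j == v) ≡ 𝟙 (i == u)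
  row i with i == u
  ... | true = ∑-indicator v
  ... | false = ∑-zero {n} _ λ _ → refl

edgeCount-deleteEdge< : ∀ {n} (G : Graph n) {u v : Fin n} → toℕ u < toℕ v → adj G u v ≡ true →
  edgeCount G ≡ suc (edgeCount (deleteEdge G u v))
edgeCount-deleteEdge< {n} G {u} {v} u<v uv = begin
  edgeCount G                                                      ≡⟨ edgeCount-∑ G ⟩
  ∑[ i < n ] ∑[ j < n ] edgeEntry G i j                            ≡⟨ sum-cong-≗ (λ i → trans (sum-cong-≗ (split i)) (∑-distrib-+ {n} _ _)) ⟩
  ∑[ i < n ] (∑[ j < n ] edgeEntry H i j + ∑[ j < n ] 𝟙 (i == u ∧ j == v))
                                                                   ≡⟨ ∑-distrib-+ {n} _ _ ⟩
  ∑[ i < n ] ∑[ j < n ] edgeEntry H i j + ∑[ i < n ] ∑[ j < n ] 𝟙 (i == u ∧ j == v)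
                                                                   ≡⟨ cong₂ _+_ (sym (edgeCount-∑ H)) (∑-indicator-pair u v) ⟩
  edgeCount H + 1                                                  ≡⟨ +-comm _ 1 ⟩
  suc (edgeCount H)                                                ∎
  where
  open ≡-Reasoning
  H = deleteEdge G u v
  split : ∀ i j → edgeEntry G i j ≡ edgeEntry H i j + 𝟙 (i == u ∧ j == v)
  split i j with sameEdge i j u v in e
  ... | false = sym (trans (cong₂ _+_ (cong (λ b → 𝟙 (b ∧ (toℕ i <ᵇ toℕ j))) (∧-identityʳ (adj G i j)))
                                      (cong 𝟙 (∨-falseˡ e)))
                            (+-identityʳ _))
  ... | true with sameEdge-sound {i = i} {j} {u} {v} e
  ... | inj₁ (refl , refl) rewrite uv | <ᵇ-true u<v | ==-refl u | ==-refl v = refl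
  ... | inj₂ (refl , refl) rewrite <ᵇ-false {toℕ v} (<⇒≤ u<v) | ∧-zeroʳ (adj G v u)
                                 | dec-false (v ≟ u) (<⇒≢ u<v ∘ cong toℕ ∘ sym) = refl

edgeCount-deleteEdge : ∀ {n} (G : Graph n) {u v : Fin n} → adj G u v ≡ true →
  edgeCount G ≡ suc (edgeCount (deleteEdge G u v))
edgeCount-deleteEdge G {u} {v} uv with <-cmp (toℕ u) (toℕ v)
... | tri< u<v _ _ = edgeCount-deleteEdge< G u<v uv
... | tri> _ _ v<u = trans (edgeCount-deleteEdge< G v<u (trans (Graph.sym G v u) uv))
                           (cong suc (edgeCount-cong (deleteEdge G v u) (deleteEdge G u v) (deleteEdge-swap G v u)))
... | tri≈ _ u≡v _ with toℕ-injective u≡v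
... | refl with trans (sym uv) (irrefl G u)
... | ()

_◅◅_ : ∀ {n} {G : Graph n} {a b c} → Walk G a b → Walk G b c → Walk G a c
here ◅◅ w = w
step e w ◅◅ w' = step e (w ◅◅ w')

reverse : ∀ {n} {G : Graph n} {a b} → Walk G a b → Walk G b a
reverse here = here
reverse {G = G} (step {u} {w} e W) = reverse W ◅◅ step (trans (Graph.sym G w u) e) here

walk-deleteEdge : ∀ {n} (G : Graph n) {u v : Fin n} → Walk (deleteEdge G u v) u v →
  ∀ {a b} → Walk G a b → Walk (deleteEdge G u v) a b
walk-deleteEdge G u⇝v here = here
walk-deleteEdge G {u} {v} u⇝v (step {a} {w} e W) with sameEdge a w u v in s
... | false = step (deleteEdge-adj G e s) (walk-deleteEdge G u⇝v W)
... | true with sameEdge-sound {i = a} {w} {u} {v} s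
... | inj₁ (refl , refl) = u⇝v ◅◅ walk-deleteEdge G u⇝v W
... | inj₂ (refl , refl) = reverse u⇝v ◅◅ walk-deleteEdge G u⇝v W

NonBridge : ∀ {n} → Graph n → Fin n → Fin n → Set
NonBridge G u v = adj G u v ≡ true × Walk (deleteEdge G u v) u v

connected-deleteNonBridge : ∀ {n} {G : Graph n} {u v : Fin n} → Connected G → NonBridge G u v →
  Connected (deleteEdge G u v)
connected-deleteNonBridge {G = G} conn (_ , u⇝v) a b = walk-deleteEdge G u⇝v (conn a b)

arcCount≤edgeCount : ∀ {N} (G : Graph N) (arc : Fin N → Fin N → Bool) →
  (∀ i j → arc i j ≡ true → adj G i j ≡ true) →
  (∀ i j → arc i j ≡ true → arc j i ≡ false) →
  ∑[ i < N ] ∑[ j < N ] 𝟙 (arc i j) ≤ edgeCount G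
arcCount≤edgeCount {N} G arc arc⇒adj antisym = begin
  ∑[ i < N ] ∑[ j < N ] 𝟙 (arc i j)
    ≡⟨ sum-cong-≗ (λ i → trans (sum-cong-≗ (split i)) (∑-distrib-+ {N} _ _)) ⟩
  ∑[ i < N ] (∑[ j < N ] forward i j + ∑[ j < N ] backward i j)
    ≡⟨ ∑-distrib-+ {N} _ _ ⟩
  ∑[ i < N ] ∑[ j < N ] forward i j + ∑[ i < N ] ∑[ j < N ] backward i j
    ≡⟨ cong (∑[ i < N ] ∑[ j < N ] forward i j +_) (∑-comm backward) ⟩
  ∑[ i < N ] ∑[ j < N ] forward i j + ∑[ i < N ] ∑[ j < N ] backward j i
    ≡⟨ sym (∑-distrib-+ {N} _ _) ⟩
  ∑[ i < N ] (∑[ j < N ] forward i j + ∑[ j < N ] backward j i)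
    ≡⟨ sum-cong-≗ (λ i → sym (∑-distrib-+ (forward i) (λ j → backward j i))) ⟩
  ∑[ i < N ] ∑[ j < N ] (forward i j + backward j i)
    ≤⟨ ∑-mono-≤ (λ i → ∑-mono-≤ (bound i)) ⟩
  ∑[ i < N ] ∑[ j < N ] edgeEntry G i j
    ≡⟨ sym (edgeCount-∑ G) ⟩
  edgeCount G ∎
  where
  open ≤-Reasoning
  forward backward : Fin N → Fin N → ℕ
  forward i j = 𝟙 (arc i j ∧ (toℕ i <ᵇ toℕ j))
  backward i j = 𝟙 (arc i j ∧ (toℕ j <ᵇ toℕ i))

  split : ∀ i j → 𝟙 (arc i j) ≡ forward i j + backward i j
  split i j with <-cmp (toℕ i) (toℕ j)
  ... | tri< i<j _ _ rewrite <ᵇ-true i<j | <ᵇ-false {toℕ j} (<⇒≤ i<j)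
                           | ∧-identityʳ (arc i j) | ∧-zeroʳ (arc i j) = sym (+-identityʳ _)
  ... | tri> _ _ j<i rewrite <ᵇ-true j<i | <ᵇ-false {toℕ i} (<⇒≤ j<i)
                           | ∧-identityʳ (arc i j) | ∧-zeroʳ (arc i j) = refl
  ... | tri≈ _ i≡j _ with toℕ-injective i≡j
  ... | refl with arc i i in a
  ...   | false = refl
  ...   | true = case trans (sym (arc⇒adj i i a)) (irrefl G i) of λ ()

  bound : ∀ i j → forward i j + backward j i ≤ edgeEntry G i j
  bound i j with toℕ i <ᵇ toℕ j
  ... | false rewrite ∧-zeroʳ (arc i j) | ∧-zeroʳ (arc j i) = z≤n
  ... | true rewrite ∧-identityʳ (arc i j) | ∧-identityʳ (arc j i) | ∧-identityʳ (adj G i j)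
        with arc i j in a | arc j i in a'
  ...   | false | false = z≤n
  ...   | true  | false rewrite arc⇒adj i j a = ≤-refl
  ...   | false | true  rewrite trans (Graph.sym G i j) (arc⇒adj j i a') = ≤-refl
  ...   | true  | true  = case trans (sym a') (antisym i j a) of λ ()

least-true : (P : ℕ → Bool) (K : ℕ) → P K ≡ true → Σ[ k ∈ ℕ ] P k ≡ true × (∀ j → P j ≡ true → k ≤ j)
least-true P zero PK = 0 , PK , λ _ _ → z≤n
least-true P (suc K) PK with P 0 in P0
... | true = 0 , P0 , λ _ _ → z≤n
... | false with least-true (P ∘ suc) K PK
... | k , Pk , least = suc k , Pk , λ
  { zero P0' → case trans (sym P0') P0 of λ () ; (suc j) Pj → s≤s (least j Pj) }

module ShortestPaths {N} (G : Graph N) (root : Fin N) (conn : Connected G) where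

  Near : ℕ → Fin N → Bool
  Near zero v = v == root
  Near (suc k) v = Near k v ∨ does (any? λ w → (adj G v w ∧ Near k w) ≟ᵇ true)

  near-walk : ∀ {v} → Walk G v root → Σ[ k ∈ ℕ ] Near k v ≡ true
  near-walk here = 0 , ==-refl root
  near-walk (step {v} {w} e W) with near-walk W
  ... | k , near = suc k , trans (cong (Near k v ∨_) (dec-true (any? _) (w , cong₂ _∧_ e near))) (∨-zeroʳ _)

  distance : ∀ v → Σ[ k ∈ ℕ ] Near k v ≡ true × (∀ j → Near j v ≡ true → k ≤ j)
  distance v = let (k , near) = near-walk (conn v root) in least-true (λ j → Near j v) k near

  dist : Fin N → ℕ
  dist v = proj₁ (distance v)

  closer-neighbour : ∀ v → v ≢ root → Σ[ w ∈ Fin N ] adj G v w ≡ true × dist w < dist v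
  closer-neighbour v v≢root = go (dist v) (proj₁ (proj₂ (distance v))) (proj₂ (proj₂ (distance v)))
    where
    go : ∀ d → Near d v ≡ true → (∀ j → Near j v ≡ true → d ≤ j) → Σ[ w ∈ Fin N ] adj G v w ≡ true × dist w < d
    go zero near _ = ⊥-elim (v≢root (==⇒≡ near))
    go (suc d) near least with ∨-true {Near d v} near
    ... | inj₁ near-d = ⊥-elim (1+n≰n (least d near-d))
    ... | inj₂ any-w with does⇒ (any? _) any-w
    ... | w , e with ∧-true {adj G v w} e
    ... | vw , near-w = w , vw , s≤s (proj₂ (proj₂ (distance w)) d near-w)

  parent : Fin N → Fin N
  parent v with v ≟ root
  ... | yes _ = root
  ... | no v≢root = proj₁ (closer-neighbour v v≢root)

  parent-spec : ∀ v → v ≢ root → adj G v (parent v) ≡ true × dist (parent v) < dist v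
  parent-spec v v≢root with v ≟ root
  ... | yes v≡root = ⊥-elim (v≢root v≡root)
  ... | no v≢root' = proj₂ (closer-neighbour v v≢root')

  treeArc : Fin N → Fin N → Bool
  treeArc i j = not (i == root) ∧ j == parent i

  treeArc-spec : ∀ i j → treeArc i j ≡ true → adj G i j ≡ true × dist j < dist i
  treeArc-spec i j e with ∧-true {not (i == root)} e
  ... | i≢root , j≡parent with does⇒ (j ≟ parent i) j≡parent
  ... | refl = parent-spec i (not-==⇒≢ i≢root)

  treeArc-count : ∑[ i < N ] ∑[ j < N ] 𝟙 (treeArc i j) + 1 ≡ N
  treeArc-count = begin
    ∑[ i < N ] ∑[ j < N ] 𝟙 (treeArc i j) + 1                  ≡⟨ cong₂ _+_ (sum-cong-≗ row) (sym (∑-indicator root)) ⟩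
    ∑[ i < N ] 𝟙 (not (i == root)) + ∑[ i < N ] 𝟙 (i == root) ≡⟨ sym (∑-distrib-+ {N} _ _) ⟩
    ∑[ i < N ] (𝟙 (not (i == root)) + 𝟙 (i == root))          ≡⟨ sum-cong-≗ (λ i → one (i == root)) ⟩
    ∑[ i < N ] 1                                               ≡⟨ ∑-one N ⟩
    N                                                          ∎
    where
    open ≡-Reasoning
    row : ∀ i → ∑[ j < N ] 𝟙 (treeArc i j) ≡ 𝟙 (not (i == root))
    row i with not (i == root)
    ... | true = ∑-indicator (parent i)
    ... | false = ∑-zero {N} _ λ _ → refl
    one : ∀ b → 𝟙 (not b) + 𝟙 b ≡ 1
    one true = refl
    one false = refl

-- Every non-root vertex has an arc to a neighbour closer to the root, and these arcs are distinct edges.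
connected⇒order≤1+edgeCount : ∀ {N} (G : Graph N) → Connected G → Fin N → N ≤ suc (edgeCount G)
connected⇒order≤1+edgeCount {N} G conn root = begin
  N                                              ≡⟨ sym treeArc-count ⟩
  ∑[ i < N ] ∑[ j < N ] 𝟙 (treeArc i j) + 1    ≤⟨ +-monoˡ-≤ 1 (arcCount≤edgeCount G treeArc arc⇒adj antisym) ⟩
  edgeCount G + 1                                ≡⟨ +-comm _ 1 ⟩
  suc (edgeCount G)                              ∎
  where
  open ShortestPaths G root conn
  open ≤-Reasoning
  arc⇒adj : ∀ i j → treeArc i j ≡ true → adj G i j ≡ true
  arc⇒adj i j = proj₁ ∘ treeArc-spec i j
  antisym : ∀ i j → treeArc i j ≡ true → treeArc j i ≡ false
  antisym i j a with treeArc j i in a'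
  ... | false = refl
  ... | true = ⊥-elim (<-asym (proj₂ (treeArc-spec i j a)) (proj₂ (treeArc-spec j i a')))

three-nonBridges⇒excess : ∀ {n} (G : Graph n) {u₁ v₁ u₂ v₂ u₃ v₃ : Fin n} → Connected G →
  NonBridge G u₁ v₁ → NonBridge (deleteEdge G u₁ v₁) u₂ v₂ →
  NonBridge (deleteEdge (deleteEdge G u₁ v₁) u₂ v₂) u₃ v₃ → n + 1 < edgeCount G
three-nonBridges⇒excess {n} G {u₁} {v₁} {u₂} {v₂} {u₃} {v₃} conn nb₁ nb₂ nb₃ = begin
  suc (n + 1)          ≡⟨ cong suc (+-comm n 1) ⟩
  2 + n                ≤⟨ +-monoʳ-≤ 2 (connected⇒order≤1+edgeCount G₃ conn₃ u₁) ⟩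
  3 + edgeCount G₃     ≡⟨ sym count ⟩
  edgeCount G          ∎
  where
  open ≤-Reasoning
  G₁ = deleteEdge G u₁ v₁
  G₂ = deleteEdge G₁ u₂ v₂
  G₃ = deleteEdge G₂ u₃ v₃
  conn₃ : Connected G₃
  conn₃ = connected-deleteNonBridge (connected-deleteNonBridge (connected-deleteNonBridge conn nb₁) nb₂) nb₃
  count : edgeCount G ≡ 3 + edgeCount G₃
  count = trans (edgeCount-deleteEdge G (proj₁ nb₁))
         (cong suc (trans (edgeCount-deleteEdge G₁ (proj₁ nb₂)) (cong suc (edgeCount-deleteEdge G₂ (proj₁ nb₃)))))

-- Paths and cycles

record Path {n} (G : Graph n) (F : ℕ → Fin n) (m : ℕ) : Set where
  constructor mkPath
  field edge : ∀ k → k < m → adj G (F k) (F (suc k)) ≡ true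

InjectiveOn : ∀ {n} → ℕ → (ℕ → Fin n) → Set
InjectiveOn m F = ∀ j k → j ≤ m → k ≤ m → F j ≡ F k → j ≡ k

record Cycle {n} (G : Graph n) (m : ℕ) (F : ℕ → Fin n) : Set where
  field
    path : Path G F m
    closes : adj G (F m) (F 0) ≡ true
    injective : InjectiveOn m F

path-walk : ∀ {n} {G : Graph n} {F m} → Path G F m → ∀ j → j ≤ m → Walk G (F 0) (F j)
path-walk P zero _ = here
path-walk P (suc j) j<m = path-walk P j (<⇒≤ j<m) ◅◅ step (Path.edge P j j<m) here

path-prefix : ∀ {n} {G : Graph n} {F m k} → k ≤ m → Path G F m → Path G F k
path-prefix k≤m (mkPath edge) = mkPath λ j j<k → edge j (<-≤-trans j<k k≤m)

path-tail : ∀ {n} {G : Graph n} {F m} → Path G F (suc m) → Path G (F ∘ suc) m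
path-tail (mkPath edge) = mkPath λ k k<m → edge (suc k) (s≤s k<m)

record PathAvoids {n} (F : ℕ → Fin n) (m : ℕ) (u v : Fin n) : Set where
  constructor mkAvoids
  field avoids : ∀ k → k < m → sameEdge (F k) (F (suc k)) u v ≡ false

path-deleteEdge : ∀ {n} {G : Graph n} {F m u v} → Path G F m → PathAvoids F m u v → Path (deleteEdge G u v) F m
path-deleteEdge {G = G} (mkPath edge) (mkAvoids avoids) = mkPath λ k k<m → deleteEdge-adj G (edge k k<m) (avoids k k<m)

pathAvoids-swap : ∀ {n} {F : ℕ → Fin n} {m u v} → PathAvoids F m u v → PathAvoids F m v u
pathAvoids-swap {F = F} {u = u} {v} (mkAvoids avoids) =
  mkAvoids λ k k<m → trans (sameEdge-symʳ (F k) (F (suc k)) v u) (avoids k k<m)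

pathAvoids-missing : ∀ {n} {F : ℕ → Fin n} {m u} v → (∀ k → k ≤ m → F k ≢ u) → PathAvoids F m u v
pathAvoids-missing v missing = mkAvoids λ k k<m → sameEdge-missing v (missing k (<⇒≤ k<m)) (missing (suc k) k<m)

pathAvoids-chord : ∀ {n} {F : ℕ → Fin n} {m i j} → InjectiveOn m F → i ≤ m → j ≤ m → suc i < j →
  PathAvoids F m (F i) (F j)
pathAvoids-chord {F = F} {m} {i} {j} inj i≤m j≤m 1+i<j = mkAvoids λ k k<m →
  sameEdge-false {i = F k} {F (suc k)} {F i} {F j} λ
    { (inj₁ (k~i , 1+k~j)) →
        <⇒≢ 1+i<j (trans (cong suc (sym (inj k i (<⇒≤ k<m) i≤m k~i))) (inj (suc k) j k<m j≤m 1+k~j))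
    ; (inj₂ (k~j , 1+k~i)) →
        <-asym (<-trans (n<1+n i) 1+i<j)
               (subst₂ _<_ (inj k j (<⇒≤ k<m) j≤m k~j) (inj (suc k) i k<m i≤m 1+k~i) (n<1+n k)) }

CycleAvoids : ∀ {n} → (ℕ → Fin n) → ℕ → Fin n → Fin n → Set
CycleAvoids F m u v = PathAvoids F m u v × sameEdge (F m) (F 0) u v ≡ false

cycleAvoids-swap : ∀ {n} {F : ℕ → Fin n} {m u v} → CycleAvoids F m u v → CycleAvoids F m v u
cycleAvoids-swap {F = F} {m} {u} {v} (avoids , closing) =
  pathAvoids-swap avoids , trans (sameEdge-symʳ (F m) (F 0) v u) closing

cycleAvoids-missing : ∀ {n} {F : ℕ → Fin n} {m u} v → (∀ k → k ≤ m → F k ≢ u) → CycleAvoids F m u v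
cycleAvoids-missing v missing = pathAvoids-missing v missing , sameEdge-missing v (missing _ ≤-refl) (missing 0 z≤n)

cycleAvoids-chord : ∀ {n} {F : ℕ → Fin n} {m i j} → InjectiveOn m F → suc i < j → j < m →
  CycleAvoids F m (F i) (F j)
cycleAvoids-chord {F = F} {m} {i} {j} inj 1+i<j j<m =
  pathAvoids-chord inj i≤m (<⇒≤ j<m) 1+i<j ,
  sameEdge-false {i = F m} {F 0} {F i} {F j} λ
    { (inj₁ (m~i , _)) → <⇒≢ (<-trans i<j j<m) (sym (inj m i ≤-refl i≤m m~i))
    ; (inj₂ (m~j , _)) → <⇒≢ j<m (sym (inj m j ≤-refl (<⇒≤ j<m) m~j)) }
  where
  i<j : i < j
  i<j = <-trans (n<1+n i) 1+i<j
  i≤m : i ≤ m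
  i≤m = <⇒≤ (<-trans i<j j<m)

append : ∀ {X : Set} → ℕ → (ℕ → X) → (ℕ → X) → ℕ → X
append zero F H zero = F 0
append zero F H (suc k) = H k
append (suc i) F H zero = F 0
append (suc i) F H (suc k) = append i (F ∘ suc) H k

append-left : ∀ {X : Set} i (F H : ℕ → X) {k} → k ≤ i → append i F H k ≡ F k
append-left zero F H z≤n = refl
append-left (suc i) F H z≤n = refl
append-left (suc i) F H (s≤s k≤i) = append-left i (F ∘ suc) H k≤i

append-right : ∀ {X : Set} i (F H : ℕ → X) k → append i F H (suc (i + k)) ≡ H k
append-right zero F H k = refl
append-right (suc i) F H k = append-right i (F ∘ suc) H k

append-view : ∀ i k → k ≤ i ⊎ Σ[ j ∈ ℕ ] k ≡ suc (i + j)
append-view zero zero = inj₁ z≤n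
append-view zero (suc k) = inj₂ (k , refl)
append-view (suc i) zero = inj₁ z≤n
append-view (suc i) (suc k) with append-view i k
... | inj₁ k≤i = inj₁ (s≤s k≤i)
... | inj₂ (j , refl) = inj₂ (j , refl)

append-right-bound : ∀ {i j k} → suc (i + k) ≤ i + suc j → k ≤ j
append-right-bound {i} {j} {k} le = +-cancelˡ-≤ i k j (≤-pred (subst (suc (i + k) ≤_) (+-suc i j) le))

append-missing : ∀ {n} {F H : ℕ → Fin n} {w} i j → (∀ a → a ≤ i → F a ≢ w) → (∀ b → b ≤ j → H b ≢ w) →
  ∀ k → k ≤ i + suc j → append i F H k ≢ w
append-missing {F = F} {H} {w} i j F∌w H∌w k k≤ with append-view i k
... | inj₁ k≤i = subst (_≢ w) (sym (append-left i F H k≤i)) (F∌w k k≤i)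
... | inj₂ (b , refl) = subst (_≢ w) (sym (append-right i F H b)) (H∌w b (append-right-bound k≤))

cycle-join : ∀ {n} {G : Graph n} {F H : ℕ → Fin n} {i j} → Path G F i → Path G H j →
  adj G (F i) (H 0) ≡ true → adj G (H j) (F 0) ≡ true → InjectiveOn i F → InjectiveOn j H →
  (∀ a b → a ≤ i → b ≤ j → F a ≢ H b) → Cycle G (i + suc j) (append i F H)
cycle-join {G = G} {F} {H} {i} {j} (mkPath F-edge) (mkPath H-edge) FH HF F-inj H-inj disjoint = record
  { path = mkPath edge
  ; closes = subst₂ (λ u w → adj G u w ≡ true)
                    (sym (trans (cong (append i F H) (+-suc i j)) (append-right i F H j))) (sym (append-left i F H z≤n)) HF
  ; injective = injective }
  where
  Edge : ℕ → ℕ → Set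
  Edge k l = adj G (append i F H k) (append i F H l) ≡ true

  edge : ∀ k → k < i + suc j → Edge k (suc k)
  edge k k< with append-view i k
  ... | inj₂ (b , refl) =
    subst₂ Edge refl (cong suc (+-suc i b))
      (subst₂ (λ u w → adj G u w ≡ true) (sym (append-right i F H b)) (sym (append-right i F H (suc b)))
              (H-edge b (append-right-bound (subst (_≤ i + suc j) (cong suc (sym (+-suc i b))) k<))))
  ... | inj₁ k≤i with m≤n⇒m<n∨m≡n k≤i
  ...   | inj₁ k<i = subst₂ (λ u w → adj G u w ≡ true) (sym (append-left i F H k≤i)) (sym (append-left i F H k<i))
                            (F-edge k k<i)
  ...   | inj₂ refl = subst₂ (λ u w → adj G u w ≡ true) (sym (append-left i F H k≤i))
                             (sym (trans (cong (λ l → append i F H (suc l)) (sym (+-identityʳ i))) (append-right i F H 0)))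
                             FH

  injective : InjectiveOn (i + suc j) (append i F H)
  injective k l k≤ l≤ e with append-view i k | append-view i l
  ... | inj₁ k≤i | inj₁ l≤i = F-inj k l k≤i l≤i (trans (sym (append-left i F H k≤i)) (trans e (append-left i F H l≤i)))
  ... | inj₁ k≤i | inj₂ (b , refl) =
    ⊥-elim (disjoint k b k≤i (append-right-bound l≤) (trans (sym (append-left i F H k≤i)) (trans e (append-right i F H b))))
  ... | inj₂ (b , refl) | inj₁ l≤i =
    ⊥-elim (disjoint l b l≤i (append-right-bound k≤) (trans (sym (append-left i F H l≤i)) (trans (sym e) (append-right i F H b))))
  ... | inj₂ (b , refl) | inj₂ (b′ , refl) =
    cong (λ c → suc (i + c)) (H-inj b b′ (append-right-bound k≤) (append-right-bound l≤)
                                   (trans (sym (append-right i F H b)) (trans e (append-right i F H b′))))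

toℕ-nextMod : ∀ {m} (i : Fin (suc m)) → toℕ i < m → toℕ (nextMod i) ≡ suc (toℕ i)
toℕ-nextMod {suc m} fzero _ = refl
toℕ-nextMod {suc m} (fsuc i) (s≤s i<m) with nextMod {m} i | toℕ-nextMod i i<m
... | fsuc j | eq = cong suc eq

nextMod-last : ∀ {m} (i : Fin (suc m)) → toℕ i ≡ m → nextMod i ≡ fzero
nextMod-last {zero} fzero _ = refl
nextMod-last {suc m} (fsuc i) eq with nextMod {m} i | nextMod-last i (suc-injective eq)
... | fzero | _ = refl

clamp : (m k : ℕ) → Fin (suc m)
clamp m zero = fzero
clamp zero (suc k) = fzero
clamp (suc m) (suc k) = fsuc (clamp m k)

toℕ-clamp : ∀ m k → k ≤ m → toℕ (clamp m k) ≡ k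
toℕ-clamp m zero _ = refl
toℕ-clamp (suc m) (suc k) (s≤s k≤m) = cong suc (toℕ-clamp m k k≤m)

Cycle⇒IsCycle : ∀ {n} {G : Graph n} {m F} → Cycle G m F → IsCycle G m (F ∘ toℕ)
Cycle⇒IsCycle {G = G} {m} {F} C = injective′ , edge
  where
  open Cycle C
  injective′ : ∀ {i j} → F (toℕ i) ≡ F (toℕ j) → i ≡ j
  injective′ {i} {j} e = toℕ-injective (injective _ _ (toℕ≤pred[n] i) (toℕ≤pred[n] j) e)
  edge : ∀ i → adj G (F (toℕ i)) (F (toℕ (nextMod i))) ≡ true
  edge i with m≤n⇒m<n∨m≡n (toℕ≤pred[n] i)
  ... | inj₁ i<m rewrite toℕ-nextMod i i<m = Path.edge path (toℕ i) i<m
  ... | inj₂ i≡m rewrite nextMod-last i i≡m | i≡m = closes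

IsCycle⇒Cycle : ∀ {n} {G : Graph n} {m c} → IsCycle G m c → Cycle G m (c ∘ clamp m)
IsCycle⇒Cycle {G = G} {m} {c} (injective , edge) = record
  { path = mkPath λ k k<m → subst (λ i → adj G (c (clamp m k)) (c i) ≡ true) (next k k<m) (edge (clamp m k))
  ; closes = subst (λ i → adj G (c (clamp m m)) (c i) ≡ true) (nextMod-last (clamp m m) (toℕ-clamp m m ≤-refl))
                   (edge (clamp m m))
  ; injective = λ j k j≤m k≤m e → trans (sym (toℕ-clamp m j j≤m)) (trans (cong toℕ (injective e)) (toℕ-clamp m k k≤m)) }
  where
  next : ∀ k → k < m → nextMod (clamp m k) ≡ clamp m (suc k)
  next k k<m = toℕ-injective (begin
    toℕ (nextMod (clamp m k))   ≡⟨ toℕ-nextMod (clamp m k) (subst (_< m) (sym (toℕ-clamp m k (<⇒≤ k<m))) k<m) ⟩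
    suc (toℕ (clamp m k))       ≡⟨ cong suc (toℕ-clamp m k (<⇒≤ k<m)) ⟩
    suc k                       ≡⟨ sym (toℕ-clamp m (suc k) k<m) ⟩
    toℕ (clamp m (suc k))       ∎)
    where open ≡-Reasoning

-- Bowties in bicyclic graphs

record Bowtie {n} (G : Graph n) (m₁ m₂ : ℕ) : Set where
  field
    A B : ℕ → Fin n
    cycleA : Cycle G m₁ A
    cycleB : Cycle G m₂ B
    centre : A 0 ≡ B 0
    apart : ∀ i j → i ≤ m₁ → j ≤ m₂ → A i ≡ B j → i ≡ 0

  apartʳ : ∀ i j → i ≤ m₁ → j ≤ m₂ → A i ≡ B j → j ≡ 0
  apartʳ i j i≤m₁ j≤m₂ e with apart i j i≤m₁ j≤m₂ e
  ... | refl = sym (Cycle.injective cycleB 0 j z≤n j≤m₂ (trans (sym centre) e))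

Bowtie⇒ContainsBowtie : ∀ {n} {G : Graph n} {m₁ m₂} → Bowtie G m₁ m₂ → ContainsBowtie G (suc m₁) (suc m₂)
Bowtie⇒ContainsBowtie β =
  A ∘ toℕ , B ∘ toℕ , Cycle⇒IsCycle cycleA , Cycle⇒IsCycle cycleB , centre ,
  λ i j e → toℕ-injective (apart _ _ (toℕ≤pred[n] i) (toℕ≤pred[n] j) e) ,
            toℕ-injective (apartʳ _ _ (toℕ≤pred[n] i) (toℕ≤pred[n] j) e)
  where open Bowtie β

ContainsBowtie⇒Bowtie : ∀ {n} {G : Graph n} {m₁ m₂} → ContainsBowtie G (suc m₁) (suc m₂) → Bowtie G m₁ m₂
ContainsBowtie⇒Bowtie {m₁ = m₁} {m₂} (c₁ , c₂ , cyc₁ , cyc₂ , centre , apart) = record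
  { A = c₁ ∘ clamp m₁
  ; B = c₂ ∘ clamp m₂
  ; cycleA = IsCycle⇒Cycle cyc₁
  ; cycleB = IsCycle⇒Cycle cyc₂
  ; centre = centre
  ; apart = λ i j i≤m₁ _ e → trans (sym (toℕ-clamp m₁ i i≤m₁)) (cong toℕ (proj₁ (apart _ _ e))) }

data OnBowtie {n} {G : Graph n} {m₁ m₂} (β : Bowtie G m₁ m₂) : Fin n → Set where
  onA : ∀ i → i ≤ m₁ → OnBowtie β (Bowtie.A β i)
  onB : ∀ j → j ≤ m₂ → OnBowtie β (Bowtie.B β j)

-- Otherwise uv, the closing edge of A and the closing edge of B could be deleted one after another
-- without disconnecting the graph.
bicyclic-bowtie-induced : ∀ {n} {G : Graph n} {m₁ m₂} (β : Bowtie G m₁ m₂) → 2 ≤ m₁ → 2 ≤ m₂ →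
  Connected G → edgeCount G ≡ n + 1 → ∀ {u v} → OnBowtie β u → OnBowtie β v → adj G u v ≡ true →
  CycleAvoids (Bowtie.A β) m₁ u v → CycleAvoids (Bowtie.B β) m₂ u v → ⊥
bicyclic-bowtie-induced {n} {G} {m₁} {m₂} β 2≤m₁ 2≤m₂ conn edges {u} {v} onU onV uv avoidsA avoidsB =
  <⇒≢ (three-nonBridges⇒excess G conn nb₁ nb₂ nb₃) (sym edges)
  where
  open Bowtie β
  open Cycle cycleA renaming (path to pathA; closes to closesA; injective to injA)
  open Cycle cycleB renaming (path to pathB; closes to closesB; injective to injB)
  G₁ = deleteEdge G u v
  G₂ = deleteEdge G₁ (A m₁) (A 0)

  A-last∉B : ∀ j → j ≤ m₂ → B j ≢ A m₁
  A-last∉B j j≤m₂ e = <⇒≢ (≤-trans (s≤s z≤n) 2≤m₁) (sym (apart m₁ j ≤-refl j≤m₂ (sym e)))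

  pathA₁ : Path G₁ A m₁
  pathA₁ = path-deleteEdge pathA (proj₁ avoidsA)
  pathB₁ : Path G₁ B m₂
  pathB₁ = path-deleteEdge pathB (proj₁ avoidsB)

  from-centre : ∀ {w} → OnBowtie β w → Walk G₁ (A 0) w
  from-centre (onA i i≤m₁) = path-walk pathA₁ i i≤m₁
  from-centre (onB j j≤m₂) = subst (λ c → Walk G₁ c (B j)) (sym centre) (path-walk pathB₁ j j≤m₂)

  nb₁ : NonBridge G u v
  nb₁ = uv , reverse (from-centre onU) ◅◅ from-centre onV

  nb₂ : NonBridge G₁ (A m₁) (A 0)
  nb₂ = deleteEdge-adj G closesA (proj₂ avoidsA) ,
        reverse (path-walk (path-deleteEdge pathA₁ (pathAvoids-swap (pathAvoids-chord injA z≤n ≤-refl 2≤m₁))) m₁ ≤-refl)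

  nb₃ : NonBridge G₂ (B m₂) (B 0)
  nb₃ = deleteEdge-adj G₁ (deleteEdge-adj G closesB (proj₂ avoidsB)) (sameEdge-missing (A 0) (A-last∉B m₂ ≤-refl) (A-last∉B 0 z≤n)) ,
        reverse (path-walk (path-deleteEdge (path-deleteEdge pathB₁ (pathAvoids-missing (A 0) A-last∉B))
                                            (pathAvoids-swap (pathAvoids-chord injB z≤n ≤-refl 2≤m₂))) m₂ ≤-refl)

-- The two-switch

module TwoSwitch {N} (G : Graph N) {a b c d : Fin N} (a≢c : a ≢ c) (b≢d : b ≢ d) where

  removed added : Fin N → Fin N → Bool
  removed i j = sameEdge i j a b ∨ sameEdge i j c d
  added i j = sameEdge i j a c ∨ sameEdge i j b d

  switched : Graph N
  switched = record
    { adj = λ i j → (adj G i j ∧ not (removed i j)) ∨ added i j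
    ; sym = symmetric
    ; irrefl = λ i → cong₂ (λ e e′ → (e ∧ not (removed i i)) ∨ e′) (irrefl G i)
                           (cong₂ _∨_ (sameEdge-loop i a≢c) (sameEdge-loop i b≢d)) }
    where
    symmetric : ∀ i j → ((adj G i j ∧ not (removed i j)) ∨ added i j) ≡ ((adj G j i ∧ not (removed j i)) ∨ added j i)
    symmetric i j rewrite Graph.sym G i j
                        | sameEdge-symˡ i j a b | sameEdge-symˡ i j c d
                        | sameEdge-symˡ i j a c | sameEdge-symˡ i j b d = refl

  switched-added : ∀ {i j} → added i j ≡ true → adj switched i j ≡ true
  switched-added {i} {j} e = trans (cong ((adj G i j ∧ not (removed i j)) ∨_) e) (∨-zeroʳ _)

  switched-ac : adj switched a c ≡ true
  switched-ac = switched-added (cong (_∨ sameEdge a c b d) (sameEdge-refl a c))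

  switched-bd : adj switched b d ≡ true
  switched-bd = switched-added (trans (cong (sameEdge b d a c ∨_) (sameEdge-refl b d)) (∨-zeroʳ _))

  switched-kept : ∀ {i j} → adj G i j ≡ true → sameEdge i j a b ≡ false → sameEdge i j c d ≡ false →
    adj switched i j ≡ true
  switched-kept e ab cd rewrite e | ab | cd = refl

  degree-exchange : ∀ i {lose gain} → (∀ j → removed i j ≡ (j == lose)) → (∀ j → added i j ≡ (j == gain)) →
    lose ≢ gain → adj G i lose ≡ true → adj G i gain ≡ false → degree switched i ≡ degree G i
  degree-exchange i {lose} {gain} rem add lose≢gain lose-edge gain-non-edge = begin
    degree switched i                                          ≡⟨ degree-∑ switched i ⟩
    ∑[ j < N ] 𝟙 ((adj G i j ∧ not (removed i j)) ∨ added i j) ≡⟨ sum-cong-≗ (λ j → cong₂ (λ r a → 𝟙 ((adj G i j ∧ not r) ∨ a)) (rem j) (add j)) ⟩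
    ∑[ j < N ] 𝟙 ((adj G i j ∧ not (j == lose)) ∨ (j == gain)) ≡⟨ ∑-exchange (adj G i) lose≢gain lose-edge gain-non-edge ⟩
    ∑[ j < N ] 𝟙 (adj G i j)                                   ≡⟨ sym (degree-∑ G i) ⟩
    degree G i                                                 ∎
    where open ≡-Reasoning

  degree-unchanged : ∀ i → (∀ j → removed i j ≡ false) → (∀ j → added i j ≡ false) → degree switched i ≡ degree G i
  degree-unchanged i rem add = begin
    degree switched i                                          ≡⟨ degree-∑ switched i ⟩
    ∑[ j < N ] 𝟙 ((adj G i j ∧ not (removed i j)) ∨ added i j) ≡⟨ sum-cong-≗ (λ j → cong₂ (λ r a → 𝟙 ((adj G i j ∧ not r) ∨ a)) (rem j) (add j)) ⟩
    ∑[ j < N ] 𝟙 ((adj G i j ∧ true) ∨ false)                  ≡⟨ sum-cong-≗ (λ j → cong 𝟙 (trans (∨-identityʳ _) (∧-identityʳ (adj G i j)))) ⟩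
    ∑[ j < N ] 𝟙 (adj G i j)                                   ≡⟨ sym (degree-∑ G i) ⟩
    degree G i                                                 ∎
    where open ≡-Reasoning

  switched-degree : a ≢ b → a ≢ d → b ≢ c → c ≢ d →
    adj G a b ≡ true → adj G c d ≡ true → adj G a c ≡ false → adj G b d ≡ false →
    ∀ i → degree switched i ≡ degree G i
  switched-degree a≢b a≢d b≢c c≢d ab cd ac bd i = by-vertex i (i ≟ a) (i ≟ b) (i ≟ c) (i ≟ d)
    where
    by-vertex : ∀ i → Dec (i ≡ a) → Dec (i ≡ b) → Dec (i ≡ c) → Dec (i ≡ d) → degree switched i ≡ degree G i
    by-vertex i (yes refl) _ _ _ =
      degree-exchange a (λ j → trans (cong₂ _∨_ (sameEdge-endpointˡ j a≢b) (sameEdge-outside j a≢c a≢d)) (∨-identityʳ _))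
                        (λ j → trans (cong₂ _∨_ (sameEdge-endpointˡ j a≢c) (sameEdge-outside j a≢b a≢d)) (∨-identityʳ _))
                        b≢c ab ac
    by-vertex i (no _) (yes refl) _ _ =
      degree-exchange b (λ j → trans (cong₂ _∨_ (sameEdge-endpointʳ j (≢-sym a≢b)) (sameEdge-outside j b≢c b≢d)) (∨-identityʳ _))
                        (λ j → trans (cong (_∨ _) (sameEdge-outside j (≢-sym a≢b) b≢c)) (sameEdge-endpointˡ j b≢d))
                        a≢d (trans (Graph.sym G b a) ab) bd
    by-vertex i (no _) (no _) (yes refl) _ =
      degree-exchange c (λ j → trans (cong (_∨ _) (sameEdge-outside j (≢-sym a≢c) (≢-sym b≢c))) (sameEdge-endpointˡ j c≢d))
                        (λ j → trans (cong₂ _∨_ (sameEdge-endpointʳ j (≢-sym a≢c)) (sameEdge-outside j (≢-sym b≢c) c≢d)) (∨-identityʳ _))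
                        (≢-sym a≢d) cd (trans (Graph.sym G c a) ac)
    by-vertex i (no _) (no _) (no _) (yes refl) =
      degree-exchange d (λ j → trans (cong (_∨ _) (sameEdge-outside j (≢-sym a≢d) (≢-sym b≢d))) (sameEdge-endpointʳ j (≢-sym c≢d)))
                        (λ j → trans (cong (_∨ _) (sameEdge-outside j (≢-sym a≢d) (≢-sym c≢d))) (sameEdge-endpointʳ j (≢-sym b≢d)))
                        (≢-sym b≢c) (trans (Graph.sym G d c) cd) (trans (Graph.sym G d b) bd)
    by-vertex i (no i≢a) (no i≢b) (no i≢c) (no i≢d) =
      degree-unchanged i (λ j → cong₂ _∨_ (sameEdge-outside j i≢a i≢b) (sameEdge-outside j i≢c i≢d))
                         (λ j → cong₂ _∨_ (sameEdge-outside j i≢a i≢c) (sameEdge-outside j i≢b i≢d))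

  path-switched : ∀ {F m} → Path G F m → PathAvoids F m a b → PathAvoids F m c d → Path switched F m
  path-switched (mkPath edge) (mkAvoids ab) (mkAvoids cd) = mkPath λ k k<m → switched-kept (edge k k<m) (ab k k<m) (cd k k<m)

module BowtieReduction {n} (G : Graph n) (t₀ s₀ : ℕ) (β : Bowtie G (3 + t₀) (2 + s₀))
  (conn : Connected G) (edges : edgeCount G ≡ n + 1) where
  open Bowtie β
  open Cycle cycleA renaming (path to pathA; closes to closesA; injective to injA)
  open Cycle cycleB renaming (path to pathB; closes to closesB; injective to injB)

  t m₁ m₂ : ℕ
  t = suc t₀
  m₁ = suc (suc t)
  m₂ = 2 + s₀

  x p q L b : Fin n
  x = A 0
  p = A t
  q = A (suc t)
  L = A m₁
  b = B 1

  A-distinct : ∀ i j → i ≤ m₁ → j ≤ m₁ → i ≢ j → A i ≢ A j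
  A-distinct i j i≤ j≤ i≢j e = i≢j (injA i j i≤ j≤ e)

  A≢Bˡ : ∀ i j → i ≤ m₁ → j ≤ m₂ → i ≢ 0 → A i ≢ B j
  A≢Bˡ i j i≤ j≤ i≢0 e = i≢0 (apart i j i≤ j≤ e)

  A≢Bʳ : ∀ i j → i ≤ m₁ → j ≤ m₂ → j ≢ 0 → A i ≢ B j
  A≢Bʳ i j i≤ j≤ j≢0 e = j≢0 (apartʳ i j i≤ j≤ e)

  t≤m₁ : t ≤ m₁
  t≤m₁ = ≤-trans (n≤1+n t) (n≤1+n (suc t))
  1+t≤m₁ : suc t ≤ m₁
  1+t≤m₁ = n≤1+n (suc t)
  1≤m₂ : 1 ≤ m₂
  1≤m₂ = s≤s z≤n

  x≢q : x ≢ q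
  x≢q = A-distinct 0 (suc t) z≤n 1+t≤m₁ λ ()
  x≢p : x ≢ p
  x≢p = A-distinct 0 t z≤n t≤m₁ λ ()
  x≢b : x ≢ b
  x≢b = A≢Bʳ 0 1 z≤n 1≤m₂ λ ()
  q≢p : q ≢ p
  q≢p = A-distinct (suc t) t 1+t≤m₁ t≤m₁ (m+1+n≢n 0)
  b≢p : b ≢ p
  b≢p = ≢-sym (A≢Bˡ t 1 t≤m₁ 1≤m₂ λ ())
  b≢q : b ≢ q
  b≢q = ≢-sym (A≢Bˡ (suc t) 1 1+t≤m₁ 1≤m₂ λ ())
  L≢x : L ≢ x
  L≢x = A-distinct m₁ 0 ≤-refl z≤n λ ()
  L≢q : L ≢ q
  L≢q = A-distinct m₁ (suc t) ≤-refl 1+t≤m₁ (m+1+n≢n 0)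
  L≢p : L ≢ p
  L≢p = A-distinct m₁ t ≤-refl t≤m₁ (m+1+n≢n 1)
  L≢b : L ≢ b
  L≢b = A≢Bˡ m₁ 1 ≤-refl 1≤m₂ λ ()

  2≤m₁ : 2 ≤ m₁
  2≤m₁ = s≤s (s≤s z≤n)
  2≤m₂ : 2 ≤ m₂
  2≤m₂ = s≤s (s≤s z≤n)

  no-edge-xq : adj G x q ≡ false
  no-edge-xq = ¬-not λ xq → bicyclic-bowtie-induced β 2≤m₁ 2≤m₂ conn edges (onA 0 z≤n) (onA (suc t) 1+t≤m₁) xq
    (cycleAvoids-chord injA (s≤s (s≤s z≤n)) ≤-refl)
    (cycleAvoids-swap (cycleAvoids-missing x λ k k≤ → ≢-sym (A≢Bˡ (suc t) k 1+t≤m₁ k≤ λ ())))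

  no-edge-bp : adj G b p ≡ false
  no-edge-bp = ¬-not λ bp → bicyclic-bowtie-induced β 2≤m₁ 2≤m₂ conn edges (onB 1 1≤m₂) (onA t t≤m₁) bp
    (cycleAvoids-missing p λ k k≤ → A≢Bʳ k 1 k≤ 1≤m₂ λ ())
    (cycleAvoids-swap (cycleAvoids-missing b λ k k≤ → ≢-sym (A≢Bˡ t k t≤m₁ k≤ λ ())))

  open TwoSwitch G x≢q b≢p public using (switched)
  open TwoSwitch G x≢q b≢p using (switched-ac; switched-bd; switched-kept; path-switched; switched-degree)

  degree-preserved : ∀ i → degree switched i ≡ degree G i
  degree-preserved = switched-degree x≢b x≢p b≢q q≢p
    (subst (λ c → adj G c b ≡ true) (sym centre) (Path.edge pathB 0 (s≤s z≤n)))
    (trans (Graph.sym G q p) (Path.edge pathA t 1+t≤m₁))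
    no-edge-xq no-edge-bp

  triangle : ℕ → Fin n
  triangle = append 0 (λ _ → x) (λ k → A (k + suc t))

  triangle-cycle : Cycle switched 2 triangle
  triangle-cycle = cycle-join (mkPath λ _ ()) (mkPath qL) switched-ac Lx
    (λ j k j≤0 k≤0 _ → trans (n≤0⇒n≡0 j≤0) (sym (n≤0⇒n≡0 k≤0)))
    (λ j k j≤1 k≤1 e → +-cancelʳ-≡ (suc t) j k (injA _ _ (+-monoˡ-≤ (suc t) j≤1) (+-monoˡ-≤ (suc t) k≤1) e))
    (λ _ k _ k≤1 → A-distinct 0 (k + suc t) z≤n (+-monoˡ-≤ (suc t) k≤1) (≢-sym (m+1+n≢0 k)))
    where
    qL : ∀ k → k < 1 → adj switched (A (k + suc t)) (A (suc k + suc t)) ≡ true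
    qL zero _ = switched-kept (Path.edge pathA (suc t) ≤-refl) (sameEdge-outside L (≢-sym x≢q) (≢-sym b≢q))
                              (trans (sameEdge-symʳ q L q p) (sameEdge-missing q q≢p L≢p))
    qL (suc k) (s≤s ())
    Lx : adj switched L x ≡ true
    Lx = switched-kept closesA (sameEdge-outside x L≢x L≢b) (sameEdge-outside x L≢q L≢p)

  long : ℕ → Fin n
  long = append t A (B ∘ suc)

  long-cycle : Cycle switched (t + suc (suc s₀)) long
  long-cycle = cycle-join
    (path-switched (path-prefix t≤m₁ pathA)
       (pathAvoids-swap (pathAvoids-missing x λ k k≤t → A≢Bʳ k 1 (≤-trans k≤t t≤m₁) 1≤m₂ λ ()))
       (pathAvoids-missing p λ k k≤t → A-distinct k (suc t) (≤-trans k≤t t≤m₁) 1+t≤m₁ (<⇒≢ (s≤s k≤t))))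
    (path-switched (path-tail pathB)
       (pathAvoids-missing b λ k k≤ → ≢-sym (A≢Bʳ 0 (suc k) z≤n (s≤s k≤) λ ()))
       (pathAvoids-missing p λ k k≤ → ≢-sym (A≢Bˡ (suc t) (suc k) 1+t≤m₁ (s≤s k≤) λ ())))
    (trans (Graph.sym switched p b) switched-bd)
    (switched-kept (subst (λ c → adj G (B m₂) c ≡ true) (sym centre) closesB)
       (sameEdge-outside x (≢-sym (A≢Bʳ 0 m₂ z≤n ≤-refl λ ())) (λ e → 1+n≢0 (suc-injective (injB m₂ 1 ≤-refl 1≤m₂ e))))
       (sameEdge-outside x (≢-sym (A≢Bˡ (suc t) m₂ 1+t≤m₁ ≤-refl λ ())) (≢-sym (A≢Bˡ t m₂ t≤m₁ ≤-refl λ ()))))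
    (λ j k j≤t k≤t e → injA j k (≤-trans j≤t t≤m₁) (≤-trans k≤t t≤m₁) e)
    (λ j k j≤ k≤ e → suc-injective (injB (suc j) (suc k) (s≤s j≤) (s≤s k≤) e))
    (λ a c a≤t c≤ → A≢Bʳ a (suc c) (≤-trans a≤t t≤m₁) (s≤s c≤) λ ())

  switched-bowtie : Bowtie switched 2 (t + suc (suc s₀))
  switched-bowtie = record
    { A = triangle
    ; B = long
    ; cycleA = triangle-cycle
    ; cycleB = long-cycle
    ; centre = refl
    ; apart = λ { zero _ _ _ _ → refl
                ; (suc k) j k<2 j≤ e → ⊥-elim (long-misses k k<2 j j≤ (sym e)) } }
    where
    long-misses : ∀ k → suc k ≤ 2 → ∀ j → j ≤ t + suc (suc s₀) → long j ≢ A (k + suc t)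
    long-misses k k<2 = append-missing t (suc s₀)
      (λ a a≤t → A-distinct a (k + suc t) (≤-trans a≤t t≤m₁) (+-monoˡ-≤ (suc t) (≤-pred k<2))
                  (<⇒≢ (≤-trans (s≤s a≤t) (m≤n+m (suc t) k))))
      (λ c c≤ → ≢-sym (A≢Bˡ (k + suc t) (suc c) (+-monoˡ-≤ (suc t) (≤-pred k<2)) (s≤s c≤) (m+1+n≢0 k)))

lemma4p2 : ∀ (n : ℕ) (D : Fin n → ℕ) → ForciblyBicyclic D →
    ∀ (r s : ℕ) → 3 ≤ r → 3 ≤ s →
    (Σ (Graph n) λ G → Realizes G D × ContainsBowtie G r s) →
    Σ (Graph n) λ G' → Realizes G' D × ContainsBowtie G' 3 (r + s ∸ 3)
lemma4p2 n D _ r s (s≤s (s≤s (s≤s {n = zero} _))) _ realization = realization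
lemma4p2 n D (_ , forced) r s (s≤s (s≤s (s≤s {n = suc t₀} _))) (s≤s (s≤s (s≤s {n = s₀} _))) (G , realizes , bowtie) =
  switched , (λ i → trans (degree-preserved i) (realizes i)) ,
  subst (ContainsBowtie switched 3) (cong suc (sym (+-suc t₀ (suc (suc s₀))))) (Bowtie⇒ContainsBowtie switched-bowtie)
  where
  open BowtieReduction G t₀ s₀ (ContainsBowtie⇒Bowtie bowtie) (proj₁ (forced G realizes)) (proj₂ (forced G realizes))
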